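{- For each closed BCCSP($A$) term $q$, A1-4+IF1-2 $\vdash q\approx\overline{q}$.
   Context: $A$ is a nonempty countable set of actions. BCCSP($A$) terms: $t::=0\mid x\mid at\mid t+t$ ($a\in A$). Transitions: $at\xrightarrow{a}t$; if $t\xrightarrow{a}t'$ then $t+u\xrightarrow{a}t'$ and $u+t\xrightarrow{a}t'$. $\mathcal{I}(q)=\{a\mid q\xrightarrow{a}\}$. Every closed term is, up to A1-4, a finite sum of summands $aq'$; write $aq'\Subset q$ if $aq'$ is a summand of $q$. The depth of a term is the length of its longest trace. For a closed term $q$, $\overline{q}$ is defined by recursion on depth: $\overline{q}=q+\sum_{a\in\mathcal{I}(q)}a\big(\overline{\sum_{aq'\Subset q}q'}\big)$. Derivation is in inequational logic (reflexivity, transitivity, substitution instances, closure under contexts; an equation abbreviates two inequations). A1: $x+y\approx y+x$; A2: $(x+y)+z\approx x+(y+z)$; A3: $x+x\approx x$; A4: $x+0\approx x$; IF1: $a(x+y)\preccurlyeq ax+ay$; IF2: $ax+a(y+z)\approx a(x+y)+ax+a(y+z)$ (for all $a\in A$). -}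

module Defs where

open import Data.Nat using (ℕ; zero; suc; _⊔_)
open import Data.Nat.Properties using () renaming (_≟_ to _≟ℕ_)
open import Data.Empty using (⊥; ⊥-elim)
open import Data.Product using (_×_; _,_; proj₁; proj₂)
open import Data.List using (List; []; _∷_; _++_; map; foldr; deduplicate; filter)
open import Function.Bundles using (_↣_; Injection)
open import Relation.Binary.PropositionalEquality using (_≡_; refl; cong)
open import Relation.Binary.Definitions using (DecidableEquality)
open import Relation.Nullary using (yes; no)

data Term (A : Set) (X : Set) : Set where
  𝟎   : Term A X
  var : X → Term A X
  _·_ : A → Term A X → Term A X
  _⊕_ : Term A X → Term A X → Term A X

infixr 7 _·_
infixl 6 _⊕_

OTerm : Set → Set
OTerm A = Term A ℕ

CTerm : Set → Set
CTerm A = Term A ⊥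

subst : {A X Y : Set} → (X → Term A Y) → Term A X → Term A Y
subst σ 𝟎 = 𝟎
subst σ (var x) = σ x
subst σ (a · t) = a · subst σ t
subst σ (t ⊕ u) = subst σ t ⊕ subst σ u

embed : {A : Set} → CTerm A → OTerm A
embed = subst (λ ())

-- the axioms A1-4, IF1, IF2 as inequations l ≼ r (equations give both directions)
module _ {A : Set} where
  private
    x y z : OTerm A
    x = var 0
    y = var 1
    z = var 2

  data Axiom : OTerm A → OTerm A → Set where
    A1  : Axiom (x ⊕ y) (y ⊕ x)
    A2  : Axiom ((x ⊕ y) ⊕ z) (x ⊕ (y ⊕ z))
    A2' : Axiom (x ⊕ (y ⊕ z)) ((x ⊕ y) ⊕ z)
    A3  : Axiom (x ⊕ x) x
    A3' : Axiom x (x ⊕ x)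
    A4  : Axiom (x ⊕ 𝟎) x
    A4' : Axiom x (x ⊕ 𝟎)
    IF1 : (a : A) → Axiom (a · (x ⊕ y)) (a · x ⊕ a · y)
    IF2  : (a : A) → Axiom (a · x ⊕ a · (y ⊕ z)) (a · (x ⊕ y) ⊕ a · x ⊕ a · (y ⊕ z))
    IF2' : (a : A) → Axiom (a · (x ⊕ y) ⊕ a · x ⊕ a · (y ⊕ z)) (a · x ⊕ a · (y ⊕ z))

  infix 4 _⊢≼_
  data _⊢≼_ : OTerm A → OTerm A → Set where
    ax    : ∀ {l r} → Axiom l r → (σ : ℕ → OTerm A) → subst σ l ⊢≼ subst σ r
    refl≼ : ∀ {t} → t ⊢≼ t
    trans≼ : ∀ {t u v} → t ⊢≼ u → u ⊢≼ v → t ⊢≼ v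
    ctx·  : ∀ {t u} (a : A) → t ⊢≼ u → a · t ⊢≼ a · u
    ctx⊕  : ∀ {t t' u u'} → t ⊢≼ t' → u ⊢≼ u' → t ⊕ u ⊢≼ t' ⊕ u'

  infix 4 _⊢≈_
  _⊢≈_ : OTerm A → OTerm A → Set
  t ⊢≈ u = (t ⊢≼ u) × (u ⊢≼ t)

decEqOf : {A : Set} → A ↣ ℕ → DecidableEquality A
decEqOf c a b with Injection.to c a ≟ℕ Injection.to c b
... | yes p = yes (Injection.injective c p)
... | no ¬p = no (λ e → ¬p (cong (Injection.to c) e))

summands : {A : Set} → CTerm A → List (A × CTerm A)
summands 𝟎 = []
summands (var ())
summands (a · t) = (a , t) ∷ []
summands (t ⊕ u) = summands t ++ summands u

Sum : {A : Set} → List (CTerm A) → CTerm A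
Sum = foldr _⊕_ 𝟎

depth : {A : Set} → CTerm A → ℕ
depth 𝟎 = 0
depth (var ())
depth (a · t) = suc (depth t)
depth (t ⊕ u) = depth t ⊔ depth u

module _ {A : Set} (_≟_ : DecidableEquality A) where
  inits : CTerm A → List A
  inits q = deduplicate _≟_ (map proj₁ (summands q))

  derivSum : A → CTerm A → CTerm A
  derivSum a q = Sum (map proj₂ (filter (λ p → proj₁ p ≟ a) (summands q)))

  -- overline, with fuel; fuel suc (depth q) suffices (inner terms have smaller depth)
  barF : ℕ → CTerm A → CTerm A
  barF zero q = q
  barF (suc n) q = q ⊕ Sum (map (λ a → a · barF n (derivSum a q)) (inits q))

  bar : CTerm A → CTerm A
  bar q = barF (suc (depth q)) q

-- Modulo A1-4 the summation operator is a semilattice, so "t absorbs r",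
-- written t ⊒ r and meaning t ≈ t + r, is a preorder closed under sums.
-- The proof consists of three absorption facts:
--   * pair-absorbs: a x + a y ⊒ a (x + y), an instance of IF2 (with z = 0);
--   * every summand a q' of q is absorbed by q (summands-absorbed);
--   * hence, for a ∈ I(q), q absorbs a(Σ_{aq'⋐q} q') (derivative-absorbed):
--     fold pair-absorbs over the a-summands, starting from one that exists.
-- Finally q ≈ barF n q by induction on the fuel n: q absorbs every added
-- summand a(barF n (Σ q')), as it absorbs a(Σ q') and Σ q' ≈ barF n (Σ q')
-- by induction hypothesis.
module Submission where

open import Defs
open import Data.Nat using (ℕ; zero; suc)
open import Data.Empty using (⊥-elim)
open import Data.Product using (_×_; _,_; proj₁; proj₂)
open import Data.List using (List; []; _∷_; map; filter)
open import Data.List.Relation.Unary.All as All using (All; []; _∷_)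
open import Data.List.Relation.Unary.All.Properties using (++⁺; map⁺)
open import Data.List.Relation.Unary.Any using (here; there)
open import Data.List.Membership.Propositional using (_∈_)
open import Data.List.Membership.Propositional.Properties using (∈-deduplicate⁻)
open import Function.Bundles using (_↣_)
open import Relation.Binary.Bundles using (Setoid)
open import Relation.Binary.Definitions using (DecidableEquality)
open import Relation.Binary.PropositionalEquality using (refl; sym)
open import Relation.Nullary using (yes; no)

module Equational {A : Set} where

  infix 4 _≈_ _⊒_

  _≈_ : OTerm A → OTerm A → Set
  _≈_ = _⊢≈_

  ≈-refl : ∀ {t} → t ≈ t
  ≈-refl = refl≼ , refl≼

  ≈-sym : ∀ {t u} → t ≈ u → u ≈ t
  ≈-sym (t≼u , u≼t) = u≼t , t≼u

  ≈-trans : ∀ {t u v} → t ≈ u → u ≈ v → t ≈ v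
  ≈-trans (t≼u , u≼t) (u≼v , v≼u) = trans≼ t≼u u≼v , trans≼ v≼u u≼t

  ≈-setoid : Setoid _ _
  ≈-setoid = record
    { Carrier = OTerm A
    ; _≈_ = _≈_
    ; isEquivalence = record { refl = ≈-refl ; sym = ≈-sym ; trans = ≈-trans }
    }

  ⊕-cong : ∀ {t t' u u'} → t ≈ t' → u ≈ u' → t ⊕ u ≈ t' ⊕ u'
  ⊕-cong (p , p') (q , q') = ctx⊕ p q , ctx⊕ p' q'

  ·-cong : ∀ {t u} (a : A) → t ≈ u → a · t ≈ a · u
  ·-cong a (p , p') = ctx· a p , ctx· a p'

  ⟨_,_,_⟩ : OTerm A → OTerm A → OTerm A → ℕ → OTerm A
  ⟨ x , y , z ⟩ 0 = x
  ⟨ x , y , z ⟩ 1 = y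
  ⟨ x , y , z ⟩ _ = z

  ⊕-comm : ∀ x y → x ⊕ y ≈ y ⊕ x
  ⊕-comm x y = ax A1 ⟨ x , y , 𝟎 ⟩ , ax A1 ⟨ y , x , 𝟎 ⟩

  ⊕-assoc : ∀ x y z → (x ⊕ y) ⊕ z ≈ x ⊕ (y ⊕ z)
  ⊕-assoc x y z = ax A2 ⟨ x , y , z ⟩ , ax A2' ⟨ x , y , z ⟩

  ⊕-idem : ∀ x → x ⊕ x ≈ x
  ⊕-idem x = ax A3 ⟨ x , 𝟎 , 𝟎 ⟩ , ax A3' ⟨ x , 𝟎 , 𝟎 ⟩

  ⊕-identityʳ : ∀ x → x ⊕ 𝟎 ≈ x
  ⊕-identityʳ x = ax A4 ⟨ x , 𝟎 , 𝟎 ⟩ , ax A4' ⟨ x , 𝟎 , 𝟎 ⟩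

  if2 : ∀ a x y z → a · x ⊕ a · (y ⊕ z) ≈ a · (x ⊕ y) ⊕ a · x ⊕ a · (y ⊕ z)
  if2 a x y z = ax (IF2 a) ⟨ x , y , z ⟩ , ax (IF2' a) ⟨ x , y , z ⟩

  open import Relation.Binary.Reasoning.Setoid ≈-setoid

  _⊒_ : OTerm A → OTerm A → Set
  t ⊒ r = t ≈ t ⊕ r

  ⊒-resp-≈ : ∀ {t r r'} → t ⊒ r → r ≈ r' → t ⊒ r'
  ⊒-resp-≈ t⊒r r≈r' = ≈-trans t⊒r (⊕-cong ≈-refl r≈r')

  ⊒-trans : ∀ {t r s} → t ⊒ r → r ⊒ s → t ⊒ s
  ⊒-trans {t} {r} {s} t⊒r r⊒s = begin
    t             ≈⟨ t⊒r ⟩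
    t ⊕ r         ≈⟨ ⊕-cong ≈-refl r⊒s ⟩
    t ⊕ (r ⊕ s)   ≈⟨ ≈-sym (⊕-assoc t r s) ⟩
    (t ⊕ r) ⊕ s   ≈⟨ ⊕-cong (≈-sym t⊒r) ≈-refl ⟩
    t ⊕ s         ∎

  ⊒-⊕ : ∀ {t r s} → t ⊒ r → t ⊒ s → t ⊒ r ⊕ s
  ⊒-⊕ {t} {r} {s} t⊒r t⊒s = begin
    t             ≈⟨ t⊒s ⟩
    t ⊕ s         ≈⟨ ⊕-cong t⊒r ≈-refl ⟩
    (t ⊕ r) ⊕ s   ≈⟨ ⊕-assoc t r s ⟩
    t ⊕ (r ⊕ s)   ∎

  ⊒-weakenˡ : ∀ {t r} u → t ⊒ r → t ⊕ u ⊒ r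
  ⊒-weakenˡ {t} {r} u t⊒r = begin
    t ⊕ u         ≈⟨ ⊕-cong t⊒r ≈-refl ⟩
    (t ⊕ r) ⊕ u   ≈⟨ ⊕-assoc t r u ⟩
    t ⊕ (r ⊕ u)   ≈⟨ ⊕-cong ≈-refl (⊕-comm r u) ⟩
    t ⊕ (u ⊕ r)   ≈⟨ ≈-sym (⊕-assoc t u r) ⟩
    (t ⊕ u) ⊕ r   ∎

  ⊒-weakenʳ : ∀ {u r} t → u ⊒ r → t ⊕ u ⊒ r
  ⊒-weakenʳ {u} {r} t u⊒r =
    ≈-trans (⊕-cong ≈-refl u⊒r) (≈-sym (⊕-assoc t u r))

  ⊒-refl : ∀ t → t ⊒ t
  ⊒-refl t = ≈-sym (⊕-idem t)

  -- IF2 with z = 0: two a-summands absorb the a-summand of their sum.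
  pair-absorbs : ∀ a x y → a · x ⊕ a · y ⊒ a · (x ⊕ y)
  pair-absorbs a x y = begin
    a · x ⊕ a · y                             ≈⟨ ⊕-cong ≈-refl (·-cong a (≈-sym (⊕-identityʳ y))) ⟩
    a · x ⊕ a · (y ⊕ 𝟎)                       ≈⟨ if2 a x y 𝟎 ⟩
    a · (x ⊕ y) ⊕ a · x ⊕ a · (y ⊕ 𝟎)         ≈⟨ ⊕-cong ≈-refl (·-cong a (⊕-identityʳ y)) ⟩
    a · (x ⊕ y) ⊕ a · x ⊕ a · y               ≈⟨ ⊕-assoc (a · (x ⊕ y)) (a · x) (a · y) ⟩
    a · (x ⊕ y) ⊕ (a · x ⊕ a · y)             ≈⟨ ⊕-comm (a · (x ⊕ y)) (a · x ⊕ a · y) ⟩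
    (a · x ⊕ a · y) ⊕ a · (x ⊕ y)             ∎

  ⊒-Sum : ∀ {t} (ss : List (CTerm A)) → All (λ s → t ⊒ embed s) ss → t ⊒ embed (Sum ss)
  ⊒-Sum []       []         = ≈-sym (⊕-identityʳ _)
  ⊒-Sum (s ∷ ss) (t⊒s ∷ ps) = ⊒-⊕ t⊒s (⊒-Sum ss ps)

module Saturation {A : Set} (_≟_ : DecidableEquality A) where
  open Equational

  AllAbsorbed : OTerm A → List (A × CTerm A) → Set
  AllAbsorbed t = All (λ { (a , q') → t ⊒ a · embed q' })

  summands-absorbed : (q : CTerm A) → AllAbsorbed (embed q) (summands q)
  summands-absorbed 𝟎       = []
  summands-absorbed (var ())
  summands-absorbed (a · q) = ⊒-refl (a · embed q) ∷ []
  summands-absorbed (q ⊕ r) =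
    ++⁺ (All.map (⊒-weakenˡ (embed r)) (summands-absorbed q))
        (All.map (⊒-weakenʳ (embed q)) (summands-absorbed r))

  bSum : A → List (A × CTerm A) → CTerm A
  bSum b L = Sum (map proj₂ (filter (λ p → proj₁ p ≟ b) L))

  bSum-absorbed-from : ∀ {t} b u (L : List (A × CTerm A)) →
    t ⊒ b · embed u → AllAbsorbed t L → t ⊒ b · embed (u ⊕ bSum b L)
  bSum-absorbed-from b u [] t⊒bu [] =
    ⊒-resp-≈ t⊒bu (·-cong b (≈-sym (⊕-identityʳ (embed u))))
  bSum-absorbed-from b u ((c , v) ∷ L) t⊒bu (t⊒cv ∷ ps) with c ≟ b
  ... | no _     = bSum-absorbed-from b u L t⊒bu ps
  ... | yes refl = ⊒-trans (⊒-⊕ t⊒bu (bSum-absorbed-from b v L t⊒cv ps))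
                           (pair-absorbs b (embed u) (embed (v ⊕ bSum b L)))

  bSum-absorbed : ∀ {t} b (L : List (A × CTerm A)) →
    b ∈ map proj₁ L → AllAbsorbed t L → t ⊒ b · embed (bSum b L)
  bSum-absorbed b ((c , v) ∷ L) b∈L (t⊒cv ∷ ps) with c ≟ b | b∈L
  ... | yes refl | _         = bSum-absorbed-from b v L t⊒cv ps
  ... | no c≢b   | here b≡c  = ⊥-elim (c≢b (sym b≡c))
  ... | no _     | there b∈L = bSum-absorbed b L b∈L ps

  derivative-absorbed : ∀ (q : CTerm A) {a} → a ∈ inits _≟_ q →
    embed q ⊒ a · embed (derivSum _≟_ a q)
  derivative-absorbed q {a} a∈I =
    bSum-absorbed a (summands q) (∈-deduplicate⁻ _≟_ _ a∈I) (summands-absorbed q)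

  barF-sound : ∀ n (q : CTerm A) → embed q ≈ embed (barF _≟_ n q)
  barF-sound zero    q = ≈-refl
  barF-sound (suc n) q = ⊒-Sum _ (map⁺ (All.tabulate absorbs-added))
    where
    absorbs-added : ∀ {a} → a ∈ inits _≟_ q →
      embed q ⊒ embed (a · barF _≟_ n (derivSum _≟_ a q))
    absorbs-added {a} a∈I =
      ⊒-resp-≈ (derivative-absorbed q a∈I) (·-cong a (barF-sound n (derivSum _≟_ a q)))

lemma5p5 : {A : Set} (countable : A ↣ ℕ) (nonempty : A) (q : CTerm A) →
    embed q ⊢≈ embed (bar (decEqOf countable) q)
lemma5p5 countable _ q = Saturation.barF-sound (decEqOf countable) (suc (depth q)) q
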